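{- If $M\to N$ in $\lambda^{hc}$, then $|M|\to|N|$ in $\lambda^{hs}$.
   Context: The calculus $\lambda^{hc}$. Simple variables $a$, audited variables $u$ (disjoint). Labels $\psi\in\{\mathsf{refl},\mathsf{trans},\beta,\beta_\Box,\mathsf{ti},\mathsf{lam},\mathsf{app},\mathsf{let},\mathsf{trpl}_{[]},\mathsf{trpl}_{::},\mathsf{d}\}$. Types $A ::= P\mid A\supset B\mid[\![s]\!]A$; codes $s ::= a\mid u\mid\lambda a^A.s\mid s\,t\mid\,!s\mid\mathsf{let}(u^A:=s,t)\mid\mathsf{TI}(\theta)$; trails $q ::= \mathsf{refl}(s)\mid\mathsf{trans}(q,q')\mid\beta(a^A.s,t)\mid\beta_\Box(s,u^A.t)\mid\mathsf{ti}(q,\theta)\mid\mathsf{lam}(a^A.q)\mid\mathsf{app}(q,q')\mid\mathsf{let}(q,u^A.q')\mid\mathsf{trpl}(\zeta)$; terms $M,N,R,S ::= a\mid u\mid\lambda a^A.M\mid M\,N\mid\,!_qM\mid\mathsf{let}(u^A:=M,N)\mid\mathsf{TI}(\vartheta)$, where $\theta,\zeta,\vartheta$ are finite maps from labels to codes, trails, terms respectively. Binding as usual, up to $\alpha$-equivalence. For a trail $q$ and a map $\vartheta$ from labels to terms, $q\vartheta$ is the term defined by recursion on $q$: if the head label of $q$ ($\mathsf{trpl}(\zeta)$ having label $\mathsf{trpl}_{[]}$ if $\zeta$ is empty, else $\mathsf{trpl}_{::}$) is not in $\mathrm{dom}(\vartheta)$ then $\vartheta(\mathsf{d})$; else $\mathsf{refl},\beta,\beta_\Box,\mathsf{ti}$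 give $\vartheta$ of their label; $\mathsf{trans}(q_1,q_2)\vartheta=\vartheta(\mathsf{trans})(q_1\vartheta)(q_2\vartheta)$, same for $\mathsf{app},\mathsf{let}$; $\mathsf{lam}(a^A.q_1)\vartheta=\vartheta(\mathsf{lam})(q_1\vartheta)$; $\mathsf{trpl}(\{\})\vartheta=\vartheta(\mathsf{trpl}_{[]})$; $\mathsf{trpl}(\{q_1/\psi_1,\vec{q'/\psi'}\})\vartheta=\vartheta(\mathsf{trpl}_{::})(q_1\vartheta)(\mathsf{trpl}(\{\vec{q'/\psi'}\})\vartheta)$. $\mathrm{src}(q)$ is the source code of a trail ($\mathrm{src}(\mathsf{refl}(s))=s$, $\mathrm{src}(\mathsf{trans}(q_1,q_2))=\mathrm{src}(q_1)$, $\mathrm{src}(\beta(a^A.s,t))=(\lambda a^A.s)t$, $\mathrm{src}(\beta_\Box(s,u^A.t))=\mathsf{let}(u^A:=\,!s,t)$, $\mathrm{src}(\mathsf{ti}(q,\theta))=\mathsf{TI}(\theta)$, congruences componentwise). $\mathrm{code}(M)$ replaces each $!_qN$ in $M$ by $!\,\mathrm{src}(q)$. Code substitution $s[t/u]$ is capture-avoiding and enters boxes; on trails it acts on all codes. Term substitution $M[N/a]$ is capture-avoiding, pointwise on $\vartheta$, and does not enter boxes: $(!_qM)[N/a]=\,!_qM$. Audited substitution on terms, $\delta=[u\mapsto(N,q,t)]$, $\delta'=[t/u]$: trail $M\times\delta$: $a\mapsto\mathsf{refl}(a)$, $u\mapsto q$, $v\mapsto\mathsf{refl}(v)$ ($v\neq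 u$), $\lambda a^A.R\mapsto\mathsf{lam}(a^A.R\times\delta)$, $R\,S\mapsto\mathsf{app}(R\times\delta,S\times\delta)$, $!_{q'}R\mapsto\mathsf{refl}(!(\mathrm{src}(q')\delta'))$, $\mathsf{let}(v^A:=R,S)\mapsto\mathsf{let}(R\times\delta,v^A.S\times\delta)$, $\mathsf{TI}(\vartheta)\mapsto\mathsf{trpl}(\vartheta\times\delta)$; term $M\ltimes\delta$: $a\mapsto a$, $u\mapsto N$, $v\mapsto v$, $\lambda a^A.R\mapsto\lambda a^A.(R\ltimes\delta)$, $R\,S\mapsto(R\ltimes\delta)(S\ltimes\delta)$, $!_{q'}R\mapsto\,!_{\mathsf{trans}(q'\delta',R\times\delta)}(R\ltimes\delta)$, $\mathsf{let}(v^A:=R,S)\mapsto\mathsf{let}(v^A:=R\ltimes\delta,S\ltimes\delta)$, $\mathsf{TI}(\vartheta)\mapsto\mathsf{TI}(\vartheta\ltimes\delta)$ (bound variables fresh). Box-free contexts $\mathcal F ::= \blacksquare\mid\lambda a^A.\mathcal F\mid\mathcal F\,M\mid M\,\mathcal F\mid\mathsf{let}(u^A:=\mathcal F,M)\mid\mathsf{let}(u^A:=M,\mathcal F)\mid\mathsf{TI}(\{\vec{M/\psi},\mathcal F/\psi',\vec{N/\psi''}\})$; $\mathcal Q_{\mathcal F}$ is the trail context obtained by replacing in $\mathcal F$ each constructor by the corresponding trail congruence ($\mathsf{lam},\mathsf{app},\mathsf{let},\mathsf{trpl}$) with $\mathsf{refl}(\mathrm{code}(M))$ for the non-hole subterms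 $M$, and $\blacksquare$ for the hole. $\lambda^{hc}$ reduction $\to$ (on terms of the form $!_qM$): $!_q\mathcal F[(\lambda a^A.M)N]\to\,!_{\mathsf{trans}(q,\mathcal Q_{\mathcal F}[\beta(a^A.\mathrm{code}(M),\mathrm{code}(N))])}\mathcal F[M[N/a]]$; $!_q\mathcal F[\mathsf{let}(u^A:=\,!_{q'}M,N)]\to\,!_{q_f}\mathcal F[N\ltimes[u\mapsto(M,q',\mathrm{src}(q'))]]$ with $q_f=\mathsf{trans}(q,\mathcal Q_{\mathcal F}[\mathsf{trans}(\beta_\Box(\mathrm{src}(q'),u^A.\mathrm{code}(N)),N\times[u\mapsto(M,q',\mathrm{src}(q'))])])$; $!_q\mathcal F[\mathsf{TI}(\vartheta)]\to\,!_{\mathsf{trans}(q,\mathcal Q_{\mathcal F}[\mathsf{ti}(q,\mathrm{code}\circ\vartheta)])}\mathcal F[q\vartheta]$; if $M\to N$ then $!_q\mathcal F[M]\to\,!_q\mathcal F[N]$. The calculus $\lambda^{hs}$: types $\tau ::= P\mid\tau\supset\sigma\mid\Box\tau$; terms $s,t ::= a\mid u\mid\lambda a^\tau.s\mid s\,t\mid\,!s\mid\mathsf{let}(u^\tau:=s,t)\mid\mathsf{TI}(\theta)$ ($\theta$ finite map labels$\to$terms); $\lambda^{hs}$ trails have the same grammar as $\lambda^{hc}$ trails with $\lambda^{hs}$ terms and types in place of codes and types, and $q\theta$ is defined by the same recursion. $s[t/a]$: capture-avoiding, not entering $!$; $s[t/u]$: capture-avoiding, entering $!$. $\lambda^{hs}$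 reduction $\to$ is the closure under all contexts $\mathcal E ::= \blacksquare\mid\lambda a^\tau.\mathcal E\mid\mathcal E\,s\mid s\,\mathcal E\mid\,!\mathcal E\mid\mathsf{let}(u^\tau:=\mathcal E,s)\mid\mathsf{let}(u^\tau:=s,\mathcal E)\mid\mathsf{TI}(\{\vec{s/\psi},\mathcal E/\psi',\vec{t/\psi''}\})$ of: $(\lambda a^\tau.s)\,t\to s[t/a]$; $\mathsf{let}(u^\tau:=\,!s,t)\to t[s/u]$; $\mathsf{TI}(\theta)\to q\theta$ for any $\lambda^{hs}$ trail $q$. Erasure: $|P|=P$, $|A\supset B|=|A|\supset|B|$, $|[\![s]\!]A|=\Box|A|$; $|a|=a$, $|u|=u$, $|\lambda a^A.M|=\lambda a^{|A|}.|M|$, $|M\,N|=|M|\,|N|$, $|!_qM|=\,!|M|$, $|\mathsf{let}(u^A:=M,N)|=\mathsf{let}(u^{|A|}:=|M|,|N|)$, $|\mathsf{TI}(\vartheta)|=\mathsf{TI}(|\cdot|\circ\vartheta)$. -}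

module Defs where

-- Conventions:
--  * de Bruijn indices (ℕ) for both sorts of variables; simple and audited
--    variables are indexed independently (two separate binder counts).
--  * a finite map from labels to X is a vector with one optional entry per
--    label (position = label's place in the fixed enumeration of labels).
--  * the order in which trpl(ζ)ϑ peels off the entries of ζ is this fixed
--    enumeration order.
--  * q ϑ is partial (ϑ(d) may be undefined): it returns a Maybe.

open import Data.Nat using (ℕ; zero; suc; _+_)
open import Data.Maybe using (Maybe; just; nothing)
open import Data.Product using (_×_; _,_; proj₁; proj₂)
open import Data.Fin using (Fin) renaming (zero to fz; suc to fs)
open import Data.Vec using (Vec; []; _∷_; lookup; _[_]≔_)
open import Relation.Binary.PropositionalEquality using (_≡_)

data Label : Set where
  lRefl lTrans lBeta lBetaBox lTi lLam lApp lLet lTrplNil lTrplCons lD : Label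

idx : Label → Fin 11
idx lRefl = fz
idx lTrans = fs fz
idx lBeta = fs (fs fz)
idx lBetaBox = fs (fs (fs fz))
idx lTi = fs (fs (fs (fs fz)))
idx lLam = fs (fs (fs (fs (fs fz))))
idx lApp = fs (fs (fs (fs (fs (fs fz)))))
idx lLet = fs (fs (fs (fs (fs (fs (fs fz))))))
idx lTrplNil = fs (fs (fs (fs (fs (fs (fs (fs fz)))))))
idx lTrplCons = fs (fs (fs (fs (fs (fs (fs (fs (fs fz))))))))
idx lD = fs (fs (fs (fs (fs (fs (fs (fs (fs (fs fz)))))))))

Map : Set → Set
Map X = Vec (Maybe X) 11

_﹫_ : {X : Set} → Map X → Label → Maybe X
m ﹫ ψ = lookup m (idx ψ)

update : {X : Set} → Map X → Label → Maybe X → Map X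
update m ψ x = m [ idx ψ ]≔ x

Ren : Set
Ren = ℕ → ℕ

liftR : Ren → Ren
liftR ρ zero = zero
liftR ρ (suc n) = suc (ρ n)

infixr 5 _⊃_
mutual
  data Ty : Set where
    base : ℕ → Ty
    _⊃_  : Ty → Ty → Ty
    ⟦_⟧_ : Code → Ty → Ty

  data Code : Set where
    cs   : ℕ → Code               -- simple variable a
    ca   : ℕ → Code               -- audited variable u
    clam : Ty → Code → Code       -- λ a^A. s   (s under the binder a)
    capp : Code → Code → Code
    cbox : Code → Code
    clet : Ty → Code → Code → Code  -- let(u^A := s, t)  (t under the binder u)
    cTI  : Map Code → Code

mutual
  renTy : Ren → Ren → Ty → Ty
  renTy rs ra (base n) = base n
  renTy rs ra (A ⊃ B) = renTy rs ra A ⊃ renTy rs ra B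
  renTy rs ra (⟦ s ⟧ A) = ⟦ renC rs ra s ⟧ renTy rs ra A

  renC : Ren → Ren → Code → Code
  renC rs ra (cs n) = cs (rs n)
  renC rs ra (ca n) = ca (ra n)
  renC rs ra (clam A s) = clam (renTy rs ra A) (renC (liftR rs) ra s)
  renC rs ra (capp s t) = capp (renC rs ra s) (renC rs ra t)
  renC rs ra (cbox s) = cbox (renC rs ra s)
  renC rs ra (clet A s t) = clet (renTy rs ra A) (renC rs ra s) (renC rs (liftR ra) t)
  renC rs ra (cTI θ) = cTI (renCV rs ra θ)

  renCV : ∀ {n} → Ren → Ren → Vec (Maybe Code) n → Vec (Maybe Code) n
  renCV rs ra [] = []
  renCV rs ra (nothing ∷ θ) = nothing ∷ renCV rs ra θ
  renCV rs ra (just s ∷ θ) = just (renC rs ra s) ∷ renCV rs ra θ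

SubC : Set
SubC = ℕ → Code

liftSubC-s : SubC → SubC
liftSubC-s σ n = renC suc (λ m → m) (σ n)

liftSubC-a : SubC → SubC
liftSubC-a σ zero = ca zero
liftSubC-a σ (suc n) = renC (λ m → m) suc (σ n)

mutual
  substTy : SubC → Ty → Ty
  substTy σ (base n) = base n
  substTy σ (A ⊃ B) = substTy σ A ⊃ substTy σ B
  substTy σ (⟦ s ⟧ A) = ⟦ substC σ s ⟧ substTy σ A

  substC : SubC → Code → Code
  substC σ (cs n) = cs n
  substC σ (ca n) = σ n
  substC σ (clam A s) = clam (substTy σ A) (substC (liftSubC-s σ) s)
  substC σ (capp s t) = capp (substC σ s) (substC σ t)
  substC σ (cbox s) = cbox (substC σ s)
  substC σ (clet A s t) = clet (substTy σ A) (substC σ s) (substC (liftSubC-a σ) t)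
  substC σ (cTI θ) = cTI (substCV σ θ)

  substCV : ∀ {n} → SubC → Vec (Maybe Code) n → Vec (Maybe Code) n
  substCV σ [] = []
  substCV σ (nothing ∷ θ) = nothing ∷ substCV σ θ
  substCV σ (just s ∷ θ) = just (substC σ s) ∷ substCV σ θ

data Trail : Set where
  refl   : Code → Trail
  trans  : Trail → Trail → Trail
  beta   : Ty → Code → Code → Trail    -- β(a^A.s, t)   (s under a)
  betaB  : Code → Ty → Code → Trail    -- β□(s, u^A.t)  (t under u)
  ti     : Trail → Map Code → Trail
  lam    : Ty → Trail → Trail          -- lam(a^A.q)    (q under a)
  app    : Trail → Trail → Trail
  tlet   : Trail → Ty → Trail → Trail  -- let(q, u^A.q') (q' under u)
  trpl   : Map Trail → Trail

mutual
  renTr : Ren → Ren → Trail → Trail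
  renTr rs ra (refl s) = refl (renC rs ra s)
  renTr rs ra (trans q q') = trans (renTr rs ra q) (renTr rs ra q')
  renTr rs ra (beta A s t) = beta (renTy rs ra A) (renC (liftR rs) ra s) (renC rs ra t)
  renTr rs ra (betaB s A t) = betaB (renC rs ra s) (renTy rs ra A) (renC rs (liftR ra) t)
  renTr rs ra (ti q θ) = ti (renTr rs ra q) (renCV rs ra θ)
  renTr rs ra (lam A q) = lam (renTy rs ra A) (renTr (liftR rs) ra q)
  renTr rs ra (app q q') = app (renTr rs ra q) (renTr rs ra q')
  renTr rs ra (tlet q A q') = tlet (renTr rs ra q) (renTy rs ra A) (renTr rs (liftR ra) q')
  renTr rs ra (trpl ζ) = trpl (renTrV rs ra ζ)

  renTrV : ∀ {n} → Ren → Ren → Vec (Maybe Trail) n → Vec (Maybe Trail) n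
  renTrV rs ra [] = []
  renTrV rs ra (nothing ∷ ζ) = nothing ∷ renTrV rs ra ζ
  renTrV rs ra (just q ∷ ζ) = just (renTr rs ra q) ∷ renTrV rs ra ζ

mutual
  substTr : SubC → Trail → Trail
  substTr σ (refl s) = refl (substC σ s)
  substTr σ (trans q q') = trans (substTr σ q) (substTr σ q')
  substTr σ (beta A s t) = beta (substTy σ A) (substC (liftSubC-s σ) s) (substC σ t)
  substTr σ (betaB s A t) = betaB (substC σ s) (substTy σ A) (substC (liftSubC-a σ) t)
  substTr σ (ti q θ) = ti (substTr σ q) (substCV σ θ)
  substTr σ (lam A q) = lam (substTy σ A) (substTr (liftSubC-s σ) q)
  substTr σ (app q q') = app (substTr σ q) (substTr σ q')
  substTr σ (tlet q A q') = tlet (substTr σ q) (substTy σ A) (substTr (liftSubC-a σ) q')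
  substTr σ (trpl ζ) = trpl (substTrV σ ζ)

  substTrV : ∀ {n} → SubC → Vec (Maybe Trail) n → Vec (Maybe Trail) n
  substTrV σ [] = []
  substTrV σ (nothing ∷ ζ) = nothing ∷ substTrV σ ζ
  substTrV σ (just q ∷ ζ) = just (substTr σ q) ∷ substTrV σ ζ

mutual
  src : Trail → Code
  src (refl s) = s
  src (trans q q') = src q
  src (beta A s t) = capp (clam A s) t
  src (betaB s A t) = clet A (cbox s) t
  src (ti q θ) = cTI θ
  src (lam A q) = clam A (src q)
  src (app q q') = capp (src q) (src q')
  src (tlet q A q') = clet A (src q) (src q')
  src (trpl ζ) = cTI (srcV ζ)

  srcV : ∀ {n} → Vec (Maybe Trail) n → Vec (Maybe Code) n
  srcV [] = []
  srcV (nothing ∷ ζ) = nothing ∷ srcV ζ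
  srcV (just q ∷ ζ) = just (src q) ∷ srcV ζ

data Term : Set where
  sv   : ℕ → Term
  av   : ℕ → Term
  lamT : Ty → Term → Term
  appT : Term → Term → Term
  box  : Trail → Term → Term
  letT : Ty → Term → Term → Term  -- let(u^A := M, N)  (N under u)
  TI   : Map Term → Term

mutual
  renT : Ren → Ren → Term → Term
  renT rs ra (sv n) = sv (rs n)
  renT rs ra (av n) = av (ra n)
  renT rs ra (lamT A M) = lamT (renTy rs ra A) (renT (liftR rs) ra M)
  renT rs ra (appT M N) = appT (renT rs ra M) (renT rs ra N)
  renT rs ra (box q M) = box (renTr rs ra q) (renT rs ra M)
  renT rs ra (letT A M N) = letT (renTy rs ra A) (renT rs ra M) (renT rs (liftR ra) N)
  renT rs ra (TI ϑ) = TI (renTV rs ra ϑ)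

  renTV : ∀ {n} → Ren → Ren → Vec (Maybe Term) n → Vec (Maybe Term) n
  renTV rs ra [] = []
  renTV rs ra (nothing ∷ ϑ) = nothing ∷ renTV rs ra ϑ
  renTV rs ra (just M ∷ ϑ) = just (renT rs ra M) ∷ renTV rs ra ϑ

mutual
  code : Term → Code
  code (sv n) = cs n
  code (av n) = ca n
  code (lamT A M) = clam A (code M)
  code (appT M N) = capp (code M) (code N)
  code (box q M) = cbox (src q)
  code (letT A M N) = clet A (code M) (code N)
  code (TI ϑ) = cTI (codeV ϑ)

  codeV : ∀ {n} → Vec (Maybe Term) n → Vec (Maybe Code) n
  codeV [] = []
  codeV (nothing ∷ ϑ) = nothing ∷ codeV ϑ
  codeV (just M ∷ ϑ) = just (code M) ∷ codeV ϑ

-- term substitution for simple variables: does not enter boxes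
-- (type annotations are left untouched: a term cannot be put into a code)
SubS : Set
SubS = ℕ → Term

liftS : SubS → SubS
liftS σ zero = sv zero
liftS σ (suc n) = renT suc (λ m → m) (σ n)

mutual
  substS : SubS → Term → Term
  substS σ (sv n) = σ n
  substS σ (av n) = av n
  substS σ (lamT A M) = lamT A (substS (liftS σ) M)
  substS σ (appT M N) = appT (substS σ M) (substS σ N)
  substS σ (box q M) = box q M
  substS σ (letT A M N) = letT A (substS σ M) (substS (λ n → renT (λ m → m) suc (σ n)) N)
  substS σ (TI ϑ) = TI (substSV σ ϑ)

  substSV : ∀ {n} → SubS → Vec (Maybe Term) n → Vec (Maybe Term) n
  substSV σ [] = []
  substSV σ (nothing ∷ ϑ) = nothing ∷ substSV σ ϑ
  substSV σ (just M ∷ ϑ) = just (substS σ M) ∷ substSV σ ϑ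

-- M [ N /a]  where a is the simple variable of the removed binder (index 0)
_[_/a] : Term → Term → Term
M [ N /a] = substS σ M
  where
  σ : SubS
  σ zero = N
  σ (suc n) = sv n

-- audited substitution δ = [u ↦ (N, q, t)], in parallel form:
-- each audited variable is sent to a (term, trail, code) triple
SubA : Set
SubA = ℕ → Term × Trail × Code

codePart : SubA → SubC
codePart σ n = proj₂ (proj₂ (σ n))

liftA-s : SubA → SubA
liftA-s σ n = renT suc (λ m → m) (proj₁ (σ n))
            , renTr suc (λ m → m) (proj₁ (proj₂ (σ n)))
            , renC suc (λ m → m) (proj₂ (proj₂ (σ n)))

liftA-a : SubA → SubA
liftA-a σ zero = av zero , refl (ca zero) , ca zero
liftA-a σ (suc n) = renT (λ m → m) suc (proj₁ (σ n))
                  , renTr (λ m → m) suc (proj₁ (proj₂ (σ n)))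
                  , renC (λ m → m) suc (proj₂ (proj₂ (σ n)))

mutual
  times : SubA → Term → Trail
  times σ (sv n) = refl (cs n)
  times σ (av n) = proj₁ (proj₂ (σ n))
  times σ (lamT A R) = lam (substTy (codePart σ) A) (times (liftA-s σ) R)
  times σ (appT R S) = app (times σ R) (times σ S)
  times σ (box q R) = refl (cbox (substC (codePart σ) (src q)))
  times σ (letT A R S) = tlet (times σ R) (substTy (codePart σ) A) (times (liftA-a σ) S)
  times σ (TI ϑ) = trpl (timesV σ ϑ)

  timesV : ∀ {n} → SubA → Vec (Maybe Term) n → Vec (Maybe Trail) n
  timesV σ [] = []
  timesV σ (nothing ∷ ϑ) = nothing ∷ timesV σ ϑ
  timesV σ (just M ∷ ϑ) = just (times σ M) ∷ timesV σ ϑ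

mutual
  ltimes : SubA → Term → Term
  ltimes σ (sv n) = sv n
  ltimes σ (av n) = proj₁ (σ n)
  ltimes σ (lamT A R) = lamT (substTy (codePart σ) A) (ltimes (liftA-s σ) R)
  ltimes σ (appT R S) = appT (ltimes σ R) (ltimes σ S)
  ltimes σ (box q R) = box (trans (substTr (codePart σ) q) (times σ R)) (ltimes σ R)
  ltimes σ (letT A R S) = letT (substTy (codePart σ) A) (ltimes σ R) (ltimes (liftA-a σ) S)
  ltimes σ (TI ϑ) = TI (ltimesV σ ϑ)

  ltimesV : ∀ {n} → SubA → Vec (Maybe Term) n → Vec (Maybe Term) n
  ltimesV σ [] = []
  ltimesV σ (nothing ∷ ϑ) = nothing ∷ ltimesV σ ϑ
  ltimesV σ (just M ∷ ϑ) = just (ltimes σ M) ∷ ltimesV σ ϑ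

-- the single audited substitution [u ↦ (N, q, t)] for the audited variable of
-- the removed binder (index 0); the other audited variables are renumbered
δ[_,_,_] : Term → Trail → Code → SubA
δ[ N , q , t ] zero = N , q , t
δ[ N , q , t ] (suc n) = av n , refl (ca n) , ca n

orElse : {X : Set} → Maybe X → Maybe X → Maybe X
orElse (just x) _ = just x
orElse nothing y = y

leafT : Map Term → Label → Maybe Term
leafT ϑ ψ = orElse (ϑ ﹫ ψ) (ϑ ﹫ lD)

un1T : Map Term → Label → Maybe Term → Maybe Term
un1T ϑ ψ x with ϑ ﹫ ψ | x
... | just f | just a = just (appT f a)
... | just f | nothing = nothing
... | nothing | _ = ϑ ﹫ lD

bin2T : Map Term → Label → Maybe Term → Maybe Term → Maybe Term
bin2T ϑ ψ x y with ϑ ﹫ ψ | x | y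
... | just f | just a | just b = just (appT (appT f a) b)
... | just f | _ | _ = nothing
... | nothing | _ | _ = ϑ ﹫ lD

mutual
  applyTr : Trail → Map Term → Maybe Term
  applyTr (refl s) ϑ = leafT ϑ lRefl
  applyTr (trans q q') ϑ = bin2T ϑ lTrans (applyTr q ϑ) (applyTr q' ϑ)
  applyTr (beta A s t) ϑ = leafT ϑ lBeta
  applyTr (betaB s A t) ϑ = leafT ϑ lBetaBox
  applyTr (ti q θ) ϑ = leafT ϑ lTi
  applyTr (lam A q) ϑ = un1T ϑ lLam (applyTr q ϑ)
  applyTr (app q q') ϑ = bin2T ϑ lApp (applyTr q ϑ) (applyTr q' ϑ)
  applyTr (tlet q A q') ϑ = bin2T ϑ lLet (applyTr q ϑ) (applyTr q' ϑ)
  applyTr (trpl ζ) ϑ = applyZ ζ ϑ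

  applyZ : ∀ {n} → Vec (Maybe Trail) n → Map Term → Maybe Term
  applyZ [] ϑ = leafT ϑ lTrplNil
  applyZ (nothing ∷ ζ) ϑ = applyZ ζ ϑ
  applyZ (just q ∷ ζ) ϑ = bin2T ϑ lTrplCons (applyTr q ϑ) (applyZ ζ ϑ)

data Ctx : Set where
  hole  : Ctx
  cLam  : Ty → Ctx → Ctx
  cAppL : Ctx → Term → Ctx
  cAppR : Term → Ctx → Ctx
  cLetL : Ty → Ctx → Term → Ctx
  cLetR : Ty → Term → Ctx → Ctx
  -- TI({ϑ, F/ψ}) : hole at label ψ, the other entries taken from ϑ
  cTIF  : Map Term → Label → Ctx → Ctx

plug : Ctx → Term → Term
plug hole M = M
plug (cLam A F) M = lamT A (plug F M)
plug (cAppL F N) M = appT (plug F M) N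
plug (cAppR N F) M = appT N (plug F M)
plug (cLetL A F N) M = letT A (plug F M) N
plug (cLetR A N F) M = letT A N (plug F M)
plug (cTIF ϑ ψ F) M = TI (update ϑ ψ (just (plug F M)))

reflV : ∀ {n} → Vec (Maybe Term) n → Vec (Maybe Trail) n
reflV [] = []
reflV (nothing ∷ ϑ) = nothing ∷ reflV ϑ
reflV (just M ∷ ϑ) = just (refl (code M)) ∷ reflV ϑ

QF : Ctx → Trail → Trail
QF hole q = q
QF (cLam A F) q = lam A (QF F q)
QF (cAppL F N) q = app (QF F q) (refl (code N))
QF (cAppR N F) q = app (refl (code N)) (QF F q)
QF (cLetL A F N) q = tlet (QF F q) A (refl (code N))
QF (cLetR A N F) q = tlet (refl (code N)) A (QF F q)
QF (cTIF ϑ ψ F) q = trpl (update (reflV ϑ) ψ (just (QF F q)))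

bindS : Ctx → ℕ
bindS hole = 0
bindS (cLam A F) = suc (bindS F)
bindS (cAppL F N) = bindS F
bindS (cAppR N F) = bindS F
bindS (cLetL A F N) = bindS F
bindS (cLetR A N F) = bindS F
bindS (cTIF ϑ ψ F) = bindS F

bindA : Ctx → ℕ
bindA hole = 0
bindA (cLam A F) = bindA F
bindA (cAppL F N) = bindA F
bindA (cAppR N F) = bindA F
bindA (cLetL A F N) = bindA F
bindA (cLetR A N F) = suc (bindA F)
bindA (cTIF ϑ ψ F) = bindA F

-- a trail q from outside F, seen at the position of F's hole (de Bruijn
-- weakening; with names this is the identity by the variable convention)
weakenF : Ctx → Trail → Trail
weakenF F q = renTr (λ n → n + bindS F) (λ n → n + bindA F) q

infix 4 _⟶_
data _⟶_ : Term → Term → Set where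
  redβ : ∀ q F A M N →
    box q (plug F (appT (lamT A M) N))
      ⟶ box (trans q (QF F (beta A (code M) (code N)))) (plug F (M [ N /a]))
  redβ□ : ∀ q F A q' M N →
    box q (plug F (letT A (box q' M) N))
      ⟶ box (trans q (QF F (trans (betaB (src q') A (code N))
                                   (times δ[ M , q' , src q' ] N))))
            (plug F (ltimes δ[ M , q' , src q' ] N))
  redTI : ∀ q F ϑ R → applyTr q ϑ ≡ just R →
    box q (plug F (TI ϑ))
      ⟶ box (trans q (QF F (ti (weakenF F q) (codeV ϑ)))) (plug F R)
  redCong : ∀ q F M N → M ⟶ N → box q (plug F M) ⟶ box q (plug F N)

infixr 5 _⇒_
data HTy : Set where
  hbase : ℕ → HTy
  _⇒_   : HTy → HTy → HTy
  □_    : HTy → HTy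

data HTerm : Set where
  hsv   : ℕ → HTerm
  hav   : ℕ → HTerm
  hlam  : HTy → HTerm → HTerm
  happ  : HTerm → HTerm → HTerm
  hbox  : HTerm → HTerm
  hlet  : HTy → HTerm → HTerm → HTerm
  hTI   : Map HTerm → HTerm

data HTrail : Set where
  hrefl  : HTerm → HTrail
  htrans : HTrail → HTrail → HTrail
  hbeta  : HTy → HTerm → HTerm → HTrail
  hbetaB : HTerm → HTy → HTerm → HTrail
  hti    : HTrail → Map HTerm → HTrail
  hlamq  : HTy → HTrail → HTrail
  happq  : HTrail → HTrail → HTrail
  hletq  : HTrail → HTy → HTrail → HTrail
  htrpl  : Map HTrail → HTrail

mutual
  renH : Ren → Ren → HTerm → HTerm
  renH rs ra (hsv n) = hsv (rs n)
  renH rs ra (hav n) = hav (ra n)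
  renH rs ra (hlam τ s) = hlam τ (renH (liftR rs) ra s)
  renH rs ra (happ s t) = happ (renH rs ra s) (renH rs ra t)
  renH rs ra (hbox s) = hbox (renH rs ra s)
  renH rs ra (hlet τ s t) = hlet τ (renH rs ra s) (renH rs (liftR ra) t)
  renH rs ra (hTI θ) = hTI (renHV rs ra θ)

  renHV : ∀ {n} → Ren → Ren → Vec (Maybe HTerm) n → Vec (Maybe HTerm) n
  renHV rs ra [] = []
  renHV rs ra (nothing ∷ θ) = nothing ∷ renHV rs ra θ
  renHV rs ra (just s ∷ θ) = just (renH rs ra s) ∷ renHV rs ra θ

hliftS : (ℕ → HTerm) → ℕ → HTerm
hliftS σ zero = hsv zero
hliftS σ (suc n) = renH suc (λ m → m) (σ n)

mutual
  hsubstS : (ℕ → HTerm) → HTerm → HTerm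
  hsubstS σ (hsv n) = σ n
  hsubstS σ (hav n) = hav n
  hsubstS σ (hlam τ s) = hlam τ (hsubstS (hliftS σ) s)
  hsubstS σ (happ s t) = happ (hsubstS σ s) (hsubstS σ t)
  hsubstS σ (hbox s) = hbox s
  hsubstS σ (hlet τ s t) = hlet τ (hsubstS σ s) (hsubstS (λ n → renH (λ m → m) suc (σ n)) t)
  hsubstS σ (hTI θ) = hTI (hsubstSV σ θ)

  hsubstSV : ∀ {n} → (ℕ → HTerm) → Vec (Maybe HTerm) n → Vec (Maybe HTerm) n
  hsubstSV σ [] = []
  hsubstSV σ (nothing ∷ θ) = nothing ∷ hsubstSV σ θ
  hsubstSV σ (just s ∷ θ) = just (hsubstS σ s) ∷ hsubstSV σ θ

hliftA : (ℕ → HTerm) → ℕ → HTerm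
hliftA σ zero = hav zero
hliftA σ (suc n) = renH (λ m → m) suc (σ n)

mutual
  hsubstA : (ℕ → HTerm) → HTerm → HTerm
  hsubstA σ (hsv n) = hsv n
  hsubstA σ (hav n) = σ n
  hsubstA σ (hlam τ s) = hlam τ (hsubstA (λ n → renH suc (λ m → m) (σ n)) s)
  hsubstA σ (happ s t) = happ (hsubstA σ s) (hsubstA σ t)
  hsubstA σ (hbox s) = hbox (hsubstA σ s)
  hsubstA σ (hlet τ s t) = hlet τ (hsubstA σ s) (hsubstA (hliftA σ) t)
  hsubstA σ (hTI θ) = hTI (hsubstAV σ θ)

  hsubstAV : ∀ {n} → (ℕ → HTerm) → Vec (Maybe HTerm) n → Vec (Maybe HTerm) n
  hsubstAV σ [] = []
  hsubstAV σ (nothing ∷ θ) = nothing ∷ hsubstAV σ θ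
  hsubstAV σ (just s ∷ θ) = just (hsubstA σ s) ∷ hsubstAV σ θ

_[_/a]ₕ : HTerm → HTerm → HTerm
s [ t /a]ₕ = hsubstS σ s
  where
  σ : ℕ → HTerm
  σ zero = t
  σ (suc n) = hsv n

_[_/u]ₕ : HTerm → HTerm → HTerm
s [ t /u]ₕ = hsubstA σ s
  where
  σ : ℕ → HTerm
  σ zero = t
  σ (suc n) = hav n

leafH : Map HTerm → Label → Maybe HTerm
leafH θ ψ = orElse (θ ﹫ ψ) (θ ﹫ lD)

un1H : Map HTerm → Label → Maybe HTerm → Maybe HTerm
un1H θ ψ x with θ ﹫ ψ | x
... | just f | just a = just (happ f a)
... | just f | nothing = nothing
... | nothing | _ = θ ﹫ lD

bin2H : Map HTerm → Label → Maybe HTerm → Maybe HTerm → Maybe HTerm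
bin2H θ ψ x y with θ ﹫ ψ | x | y
... | just f | just a | just b = just (happ (happ f a) b)
... | just f | _ | _ = nothing
... | nothing | _ | _ = θ ﹫ lD

mutual
  applyH : HTrail → Map HTerm → Maybe HTerm
  applyH (hrefl s) θ = leafH θ lRefl
  applyH (htrans q q') θ = bin2H θ lTrans (applyH q θ) (applyH q' θ)
  applyH (hbeta τ s t) θ = leafH θ lBeta
  applyH (hbetaB s τ t) θ = leafH θ lBetaBox
  applyH (hti q θ') θ = leafH θ lTi
  applyH (hlamq τ q) θ = un1H θ lLam (applyH q θ)
  applyH (happq q q') θ = bin2H θ lApp (applyH q θ) (applyH q' θ)
  applyH (hletq q τ q') θ = bin2H θ lLet (applyH q θ) (applyH q' θ)
  applyH (htrpl ζ) θ = applyHZ ζ θ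

  applyHZ : ∀ {n} → Vec (Maybe HTrail) n → Map HTerm → Maybe HTerm
  applyHZ [] θ = leafH θ lTrplNil
  applyHZ (nothing ∷ ζ) θ = applyHZ ζ θ
  applyHZ (just q ∷ ζ) θ = bin2H θ lTrplCons (applyH q θ) (applyHZ ζ θ)

infix 4 _⟶ₕ_
data _⟶ₕ_ : HTerm → HTerm → Set where
  hβ     : ∀ τ s t → happ (hlam τ s) t ⟶ₕ s [ t /a]ₕ
  hβ□    : ∀ τ s t → hlet τ (hbox s) t ⟶ₕ t [ s /u]ₕ
  hTIred : ∀ θ (q : HTrail) s → applyH q θ ≡ just s → hTI θ ⟶ₕ s
  cλ     : ∀ τ {s s'} → s ⟶ₕ s' → hlam τ s ⟶ₕ hlam τ s'
  cappL  : ∀ {s s'} t → s ⟶ₕ s' → happ s t ⟶ₕ happ s' t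
  cappR  : ∀ s {t t'} → t ⟶ₕ t' → happ s t ⟶ₕ happ s t'
  c!     : ∀ {s s'} → s ⟶ₕ s' → hbox s ⟶ₕ hbox s'
  cletL  : ∀ τ {s s'} t → s ⟶ₕ s' → hlet τ s t ⟶ₕ hlet τ s' t
  cletR  : ∀ τ s {t t'} → t ⟶ₕ t' → hlet τ s t ⟶ₕ hlet τ s t'
  cTI    : ∀ θ ψ {s s'} → θ ﹫ ψ ≡ just s → s ⟶ₕ s' →
           hTI θ ⟶ₕ hTI (update θ ψ (just s'))

eraseTy : Ty → HTy
eraseTy (base n) = hbase n
eraseTy (A ⊃ B) = eraseTy A ⇒ eraseTy B
eraseTy (⟦ s ⟧ A) = □ eraseTy A

mutual
  ∣_∣ : Term → HTerm
  ∣ sv n ∣ = hsv n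
  ∣ av n ∣ = hav n
  ∣ lamT A M ∣ = hlam (eraseTy A) ∣ M ∣
  ∣ appT M N ∣ = happ ∣ M ∣ ∣ N ∣
  ∣ box q M ∣ = hbox ∣ M ∣
  ∣ letT A M N ∣ = hlet (eraseTy A) ∣ M ∣ ∣ N ∣
  ∣ TI ϑ ∣ = hTI (eraseV ϑ)

  eraseV : ∀ {n} → Vec (Maybe Term) n → Vec (Maybe HTerm) n
  eraseV [] = []
  eraseV (nothing ∷ ϑ) = nothing ∷ eraseV ϑ
  eraseV (just M ∷ ϑ) = just ∣ M ∣ ∷ eraseV ϑ

-- Erasure forgets the trail of every box, and each λ^hc rule is a λ^hs rule
-- acting on the erased redex inside an erased context: a β-step erases to a
-- β-step because erasure commutes with simple substitution (neither enters
-- boxes); a β□-step erases to a β□-step because the term part of the audited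
-- substitution M ⋉ [u ↦ (N, q, t)] is, after erasure, the plain substitution
-- of |N| for u (the trails it builds inside boxes are erased); and a TI-step
-- erases to a TI-step with the erased trail, since evaluating a trail at ϑ
-- depends only on its skeleton of labels and commutes with erasure.
module Submission where

open import Defs
open import Data.Nat using (ℕ; zero; suc)
open import Data.Maybe using (Maybe; just; nothing)
import Data.Maybe as Maybe
open import Data.Product using (proj₁)
open import Data.Vec using (Vec; []; _∷_; lookup; _[_]≔_; map)
open import Data.Vec.Properties using (lookup-map; map-[]≔; lookup∘update; []≔-idempotent)
open import Function using (_∘_)
open import Relation.Binary.PropositionalEquality
  using (_≡_; _≗_; refl; sym; cong; cong₂; subst; module ≡-Reasoning)
  renaming (trans to ≡-trans)

eraseTy-renTy : ∀ rs ra A → eraseTy (renTy rs ra A) ≡ eraseTy A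
eraseTy-renTy rs ra (base n)  = refl
eraseTy-renTy rs ra (A ⊃ B)   = cong₂ _⇒_ (eraseTy-renTy rs ra A) (eraseTy-renTy rs ra B)
eraseTy-renTy rs ra (⟦ s ⟧ A) = cong □_ (eraseTy-renTy rs ra A)

eraseTy-substTy : ∀ σ A → eraseTy (substTy σ A) ≡ eraseTy A
eraseTy-substTy σ (base n)  = refl
eraseTy-substTy σ (A ⊃ B)   = cong₂ _⇒_ (eraseTy-substTy σ A) (eraseTy-substTy σ B)
eraseTy-substTy σ (⟦ s ⟧ A) = cong □_ (eraseTy-substTy σ A)

hlet-cong : ∀ {τ τ' s s' t t'} → τ ≡ τ' → s ≡ s' → t ≡ t' → hlet τ s t ≡ hlet τ' s' t'
hlet-cong refl refl refl = refl

eraseV≡map : ∀ {n} (ϑ : Vec (Maybe Term) n) → eraseV ϑ ≡ map (Maybe.map ∣_∣) ϑ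
eraseV≡map []            = refl
eraseV≡map (nothing ∷ ϑ) = cong (nothing ∷_) (eraseV≡map ϑ)
eraseV≡map (just M ∷ ϑ)  = cong (just ∣ M ∣ ∷_) (eraseV≡map ϑ)

lookup-eraseV : ∀ {n} (ϑ : Vec (Maybe Term) n) i →
                lookup (eraseV ϑ) i ≡ Maybe.map ∣_∣ (lookup ϑ i)
lookup-eraseV ϑ i = ≡-trans (cong (λ v → lookup v i) (eraseV≡map ϑ)) (lookup-map i _ ϑ)

eraseV-update : ∀ {n} (ϑ : Vec (Maybe Term) n) i M →
                eraseV (ϑ [ i ]≔ just M) ≡ eraseV ϑ [ i ]≔ just ∣ M ∣
eraseV-update ϑ i M = begin
  eraseV (ϑ [ i ]≔ just M)              ≡⟨ eraseV≡map (ϑ [ i ]≔ just M) ⟩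
  map (Maybe.map ∣_∣) (ϑ [ i ]≔ just M) ≡⟨ map-[]≔ _ ϑ i ⟩
  map (Maybe.map ∣_∣) ϑ [ i ]≔ just ∣ M ∣ ≡⟨ cong (_[ i ]≔ just ∣ M ∣) (sym (eraseV≡map ϑ)) ⟩
  eraseV ϑ [ i ]≔ just ∣ M ∣            ∎
  where open ≡-Reasoning

mutual
  erase-renT : ∀ rs ra M → ∣ renT rs ra M ∣ ≡ renH rs ra ∣ M ∣
  erase-renT rs ra (sv n)       = refl
  erase-renT rs ra (av n)       = refl
  erase-renT rs ra (lamT A M)   =
    cong₂ hlam (eraseTy-renTy rs ra A) (erase-renT (liftR rs) ra M)
  erase-renT rs ra (appT M N)   = cong₂ happ (erase-renT rs ra M) (erase-renT rs ra N)
  erase-renT rs ra (box q M)    = cong hbox (erase-renT rs ra M)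
  erase-renT rs ra (letT A M N) =
    hlet-cong (eraseTy-renTy rs ra A) (erase-renT rs ra M) (erase-renT rs (liftR ra) N)
  erase-renT rs ra (TI ϑ)       = cong hTI (erase-renTV rs ra ϑ)

  erase-renTV : ∀ {n} rs ra (ϑ : Vec (Maybe Term) n) →
                eraseV (renTV rs ra ϑ) ≡ renHV rs ra (eraseV ϑ)
  erase-renTV rs ra []            = refl
  erase-renTV rs ra (nothing ∷ ϑ) = cong (nothing ∷_) (erase-renTV rs ra ϑ)
  erase-renTV rs ra (just M ∷ ϑ)  =
    cong₂ (λ s θ → just s ∷ θ) (erase-renT rs ra M) (erase-renTV rs ra ϑ)

erase-renT-≗ : ∀ rs ra {σ : ℕ → Term} {σ' : ℕ → HTerm} →
               ∣_∣ ∘ σ ≗ σ' → ∣_∣ ∘ renT rs ra ∘ σ ≗ renH rs ra ∘ σ'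
erase-renT-≗ rs ra {σ} σ≗σ' n = ≡-trans (erase-renT rs ra (σ n)) (cong (renH rs ra) (σ≗σ' n))

mutual
  erase-substS : ∀ σ σ' → ∣_∣ ∘ σ ≗ σ' → ∀ M → ∣ substS σ M ∣ ≡ hsubstS σ' ∣ M ∣
  erase-substS σ σ' σ≗σ' (sv n)       = σ≗σ' n
  erase-substS σ σ' σ≗σ' (av n)       = refl
  erase-substS σ σ' σ≗σ' (lamT A M)   =
    cong (hlam (eraseTy A)) (erase-substS (liftS σ) (hliftS σ') lift≗ M)
    where
    lift≗ : ∣_∣ ∘ liftS σ ≗ hliftS σ'
    lift≗ zero    = refl
    lift≗ (suc n) = erase-renT-≗ suc (λ m → m) σ≗σ' n
  erase-substS σ σ' σ≗σ' (appT M N)   =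
    cong₂ happ (erase-substS σ σ' σ≗σ' M) (erase-substS σ σ' σ≗σ' N)
  erase-substS σ σ' σ≗σ' (box q M)    = refl
  erase-substS σ σ' σ≗σ' (letT A M N) =
    cong₂ (hlet (eraseTy A)) (erase-substS σ σ' σ≗σ' M)
      (erase-substS _ _ (erase-renT-≗ (λ m → m) suc σ≗σ') N)
  erase-substS σ σ' σ≗σ' (TI ϑ)       = cong hTI (erase-substSV σ σ' σ≗σ' ϑ)

  erase-substSV : ∀ {n} σ σ' → ∣_∣ ∘ σ ≗ σ' → (ϑ : Vec (Maybe Term) n) →
                  eraseV (substSV σ ϑ) ≡ hsubstSV σ' (eraseV ϑ)
  erase-substSV σ σ' σ≗σ' []            = refl
  erase-substSV σ σ' σ≗σ' (nothing ∷ ϑ) = cong (nothing ∷_) (erase-substSV σ σ' σ≗σ' ϑ)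
  erase-substSV σ σ' σ≗σ' (just M ∷ ϑ)  =
    cong₂ (λ s θ → just s ∷ θ) (erase-substS σ σ' σ≗σ' M) (erase-substSV σ σ' σ≗σ' ϑ)

erase-[/a] : ∀ M N → ∣ M [ N /a] ∣ ≡ ∣ M ∣ [ ∣ N ∣ /a]ₕ
erase-[/a] M N = erase-substS _ _ (λ { zero → refl ; (suc n) → refl }) M

mutual
  erase-ltimes : ∀ σ σ' → ∣_∣ ∘ proj₁ ∘ σ ≗ σ' → ∀ M → ∣ ltimes σ M ∣ ≡ hsubstA σ' ∣ M ∣
  erase-ltimes σ σ' σ≗σ' (sv n)       = refl
  erase-ltimes σ σ' σ≗σ' (av n)       = σ≗σ' n
  erase-ltimes σ σ' σ≗σ' (lamT A M)   =
    cong₂ hlam (eraseTy-substTy (codePart σ) A)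
      (erase-ltimes (liftA-s σ) _ (erase-renT-≗ suc (λ m → m) σ≗σ') M)
  erase-ltimes σ σ' σ≗σ' (appT M N)   =
    cong₂ happ (erase-ltimes σ σ' σ≗σ' M) (erase-ltimes σ σ' σ≗σ' N)
  erase-ltimes σ σ' σ≗σ' (box q M)    = cong hbox (erase-ltimes σ σ' σ≗σ' M)
  erase-ltimes σ σ' σ≗σ' (letT A M N) =
    hlet-cong (eraseTy-substTy (codePart σ) A) (erase-ltimes σ σ' σ≗σ' M)
              (erase-ltimes (liftA-a σ) (hliftA σ') lift≗ N)
    where
    lift≗ : ∣_∣ ∘ proj₁ ∘ liftA-a σ ≗ hliftA σ'
    lift≗ zero    = refl
    lift≗ (suc n) = erase-renT-≗ (λ m → m) suc σ≗σ' n
  erase-ltimes σ σ' σ≗σ' (TI ϑ)       = cong hTI (erase-ltimesV σ σ' σ≗σ' ϑ)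

  erase-ltimesV : ∀ {n} σ σ' → ∣_∣ ∘ proj₁ ∘ σ ≗ σ' → (ϑ : Vec (Maybe Term) n) →
                  eraseV (ltimesV σ ϑ) ≡ hsubstAV σ' (eraseV ϑ)
  erase-ltimesV σ σ' σ≗σ' []            = refl
  erase-ltimesV σ σ' σ≗σ' (nothing ∷ ϑ) = cong (nothing ∷_) (erase-ltimesV σ σ' σ≗σ' ϑ)
  erase-ltimesV σ σ' σ≗σ' (just M ∷ ϑ)  =
    cong₂ (λ s θ → just s ∷ θ) (erase-ltimes σ σ' σ≗σ' M) (erase-ltimesV σ σ' σ≗σ' ϑ)

erase-⋉δ : ∀ M q t N → ∣ ltimes δ[ M , q , t ] N ∣ ≡ ∣ N ∣ [ ∣ M ∣ /u]ₕ
erase-⋉δ M q t N = erase-ltimes _ _ (λ { zero → refl ; (suc n) → refl }) N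

hTI-update-⟶ₕ : ∀ θ ψ {s s'} → s ⟶ₕ s' →
                hTI (update θ ψ (just s)) ⟶ₕ hTI (update θ ψ (just s'))
hTI-update-⟶ₕ θ ψ {s} {s'} s⟶s' =
  subst (λ θ' → hTI (update θ ψ (just s)) ⟶ₕ hTI θ')
        ([]≔-idempotent θ (idx ψ))
        (cTI (update θ ψ (just s)) ψ (lookup∘update (idx ψ) θ (just s)) s⟶s')

⟶ₕ-plug : ∀ F {M N} → ∣ M ∣ ⟶ₕ ∣ N ∣ → ∣ plug F M ∣ ⟶ₕ ∣ plug F N ∣
⟶ₕ-plug hole          r = r
⟶ₕ-plug (cLam A F)    r = cλ _ (⟶ₕ-plug F r)
⟶ₕ-plug (cAppL F N)   r = cappL _ (⟶ₕ-plug F r)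
⟶ₕ-plug (cAppR N F)   r = cappR _ (⟶ₕ-plug F r)
⟶ₕ-plug (cLetL A F N) r = cletL _ _ (⟶ₕ-plug F r)
⟶ₕ-plug (cLetR A N F) r = cletR _ _ (⟶ₕ-plug F r)
⟶ₕ-plug (cTIF ϑ ψ F) {M} {N} r
  rewrite eraseV-update ϑ (idx ψ) (plug F M) | eraseV-update ϑ (idx ψ) (plug F N)
  = hTI-update-⟶ₕ (eraseV ϑ) ψ (⟶ₕ-plug F r)

mutual
  eraseCode : Code → HTerm
  eraseCode (cs n)       = hsv n
  eraseCode (ca n)       = hav n
  eraseCode (clam A s)   = hlam (eraseTy A) (eraseCode s)
  eraseCode (capp s t)   = happ (eraseCode s) (eraseCode t)
  eraseCode (cbox s)     = hbox (eraseCode s)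
  eraseCode (clet A s t) = hlet (eraseTy A) (eraseCode s) (eraseCode t)
  eraseCode (cTI θ)      = hTI (eraseCodeV θ)

  eraseCodeV : ∀ {n} → Vec (Maybe Code) n → Vec (Maybe HTerm) n
  eraseCodeV []            = []
  eraseCodeV (nothing ∷ θ) = nothing ∷ eraseCodeV θ
  eraseCodeV (just s ∷ θ)  = just (eraseCode s) ∷ eraseCodeV θ

mutual
  eraseTrail : Trail → HTrail
  eraseTrail (refl s)      = hrefl (eraseCode s)
  eraseTrail (trans q q')  = htrans (eraseTrail q) (eraseTrail q')
  eraseTrail (beta A s t)  = hbeta (eraseTy A) (eraseCode s) (eraseCode t)
  eraseTrail (betaB s A t) = hbetaB (eraseCode s) (eraseTy A) (eraseCode t)
  eraseTrail (ti q θ)      = hti (eraseTrail q) (eraseCodeV θ)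
  eraseTrail (lam A q)     = hlamq (eraseTy A) (eraseTrail q)
  eraseTrail (app q q')    = happq (eraseTrail q) (eraseTrail q')
  eraseTrail (tlet q A q') = hletq (eraseTrail q) (eraseTy A) (eraseTrail q')
  eraseTrail (trpl ζ)      = htrpl (eraseTrailV ζ)

  eraseTrailV : ∀ {n} → Vec (Maybe Trail) n → Vec (Maybe HTrail) n
  eraseTrailV []            = []
  eraseTrailV (nothing ∷ ζ) = nothing ∷ eraseTrailV ζ
  eraseTrailV (just q ∷ ζ)  = just (eraseTrail q) ∷ eraseTrailV ζ

map-orElse : ∀ {X Y : Set} (f : X → Y) x y →
             Maybe.map f (orElse x y) ≡ orElse (Maybe.map f x) (Maybe.map f y)
map-orElse f (just x) y = refl
map-orElse f nothing  y = refl

leafH-erase : ∀ ϑ ψ → leafH (eraseV ϑ) ψ ≡ Maybe.map ∣_∣ (leafT ϑ ψ)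
leafH-erase ϑ ψ = begin
  orElse (lookup (eraseV ϑ) (idx ψ)) (lookup (eraseV ϑ) (idx lD))
    ≡⟨ cong₂ orElse (lookup-eraseV ϑ (idx ψ)) (lookup-eraseV ϑ (idx lD)) ⟩
  orElse (Maybe.map ∣_∣ (ϑ ﹫ ψ)) (Maybe.map ∣_∣ (ϑ ﹫ lD))
    ≡⟨ sym (map-orElse ∣_∣ (ϑ ﹫ ψ) (ϑ ﹫ lD)) ⟩
  Maybe.map ∣_∣ (leafT ϑ ψ) ∎
  where open ≡-Reasoning

un1H-erase : ∀ ϑ ψ x → un1H (eraseV ϑ) ψ (Maybe.map ∣_∣ x) ≡ Maybe.map ∣_∣ (un1T ϑ ψ x)
un1H-erase ϑ ψ x rewrite lookup-eraseV ϑ (idx ψ) with ϑ ﹫ ψ | x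
... | just f  | just a  = refl
... | just f  | nothing = refl
... | nothing | _       = lookup-eraseV ϑ (idx lD)

bin2H-erase : ∀ ϑ ψ x y → bin2H (eraseV ϑ) ψ (Maybe.map ∣_∣ x) (Maybe.map ∣_∣ y)
                          ≡ Maybe.map ∣_∣ (bin2T ϑ ψ x y)
bin2H-erase ϑ ψ x y rewrite lookup-eraseV ϑ (idx ψ) with ϑ ﹫ ψ | x | y
... | just f  | just a  | just b  = refl
... | just f  | just a  | nothing = refl
... | just f  | nothing | _       = refl
... | nothing | _       | _       = lookup-eraseV ϑ (idx lD)

mutual
  applyH-erase : ∀ q ϑ → applyH (eraseTrail q) (eraseV ϑ) ≡ Maybe.map ∣_∣ (applyTr q ϑ)
  applyH-erase (refl s)      ϑ = leafH-erase ϑ lRefl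
  applyH-erase (trans q q')  ϑ
    rewrite applyH-erase q ϑ | applyH-erase q' ϑ = bin2H-erase ϑ lTrans _ _
  applyH-erase (beta A s t)  ϑ = leafH-erase ϑ lBeta
  applyH-erase (betaB s A t) ϑ = leafH-erase ϑ lBetaBox
  applyH-erase (ti q θ)      ϑ = leafH-erase ϑ lTi
  applyH-erase (lam A q)     ϑ rewrite applyH-erase q ϑ = un1H-erase ϑ lLam _
  applyH-erase (app q q')    ϑ
    rewrite applyH-erase q ϑ | applyH-erase q' ϑ = bin2H-erase ϑ lApp _ _
  applyH-erase (tlet q A q') ϑ
    rewrite applyH-erase q ϑ | applyH-erase q' ϑ = bin2H-erase ϑ lLet _ _
  applyH-erase (trpl ζ)      ϑ = applyHZ-erase ζ ϑ

  applyHZ-erase : ∀ {n} (ζ : Vec (Maybe Trail) n) ϑ →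
                  applyHZ (eraseTrailV ζ) (eraseV ϑ) ≡ Maybe.map ∣_∣ (applyZ ζ ϑ)
  applyHZ-erase []            ϑ = leafH-erase ϑ lTrplNil
  applyHZ-erase (nothing ∷ ζ) ϑ = applyHZ-erase ζ ϑ
  applyHZ-erase (just q ∷ ζ)  ϑ
    rewrite applyH-erase q ϑ | applyHZ-erase ζ ϑ = bin2H-erase ϑ lTrplCons _ _

mainTheorem6 : ∀ {M N : Term} → M ⟶ N → ∣ M ∣ ⟶ₕ ∣ N ∣
mainTheorem6 (redβ q F A M N) =
  c! (⟶ₕ-plug F (subst (_⟶ₕ_ _) (sym (erase-[/a] M N)) (hβ _ _ _)))
mainTheorem6 (redβ□ q F A q' M N) =
  c! (⟶ₕ-plug F (subst (_⟶ₕ_ _) (sym (erase-⋉δ M q' (src q') N)) (hβ□ _ _ _)))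
mainTheorem6 (redTI q F ϑ R qϑ≡R) =
  c! (⟶ₕ-plug F (hTIred _ (eraseTrail q) _
                   (≡-trans (applyH-erase q ϑ) (cong (Maybe.map ∣_∣) qϑ≡R))))
mainTheorem6 (redCong q F M N M⟶N) = c! (⟶ₕ-plug F (mainTheorem6 M⟶N))
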